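{- Let $\mathcal{G}$ be a finite abstract simplicial complex, $R$ a commutative ring, and $h:\mathcal{G}\times\mathcal{G}\to R$ an arbitrary function. For $A\subseteq\mathcal{G}$ define the internal energy $\omega_h(A)=\sum_{x,y\in\mathcal{G},\ x\cap y\in A}h(x,y)$, and for $x,y\in\mathcal{G}$ define $$g(x,y)=\omega(x)\,\omega(y)\,\omega_h\big(U(x)\cap U(y)\big),$$ where $\omega(x)=(-1)^{\dim x}$ and $U(x)=\{z\in\mathcal{G}:x\subseteq z\}$. Then $$\sum_{x,y\in\mathcal{G}}g(x,y)=\omega_h(\mathcal{G}).$$
   Context: A finite abstract simplicial complex $\mathcal{G}$ is a finite set of non-empty finite sets such that every non-empty subset of an element of $\mathcal{G}$ is again in $\mathcal{G}$; $\dim x=|x|-1$. The condition $x\cap y\in A$ requires in particular $x\cap y\neq\emptyset$; $\omega_h(\emptyset)=0$. -}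

module Defs where

open import Level using (Level)
open import Data.Nat using (ℕ; zero; suc)
open import Data.Bool using (Bool; true; false; if_then_else_)
import Data.Bool as Bool
open import Data.Fin.Subset using (Subset; _∩_; _⊆_; ∣_∣; Nonempty)
open import Data.Fin.Subset.Properties using (_⊆?_)
open import Data.Vec.Properties using (≡-dec)
open import Data.List using (List; []; _∷_; foldr; filter)
open import Data.List.Membership.Propositional using (_∈_)
open import Data.List.Membership.DecPropositional using () renaming (_∈?_ to ∈?-gen)
open import Data.List.Relation.Unary.All using (All)
open import Data.List.Relation.Unary.Unique.Propositional using (Unique)
open import Data.Product using (_×_)
open import Relation.Nullary using (Dec; yes; no)
open import Relation.Nullary.Decidable using (_×-dec_; does)
open import Relation.Binary.PropositionalEquality using (_≡_)
open import Relation.Binary using (DecidableEquality)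
open import Algebra.Bundles using (CommutativeRing)

_≟ₛ_ : ∀ {n} → DecidableEquality (Subset n)
_≟ₛ_ = ≡-dec Bool._≟_

_∈?_ : ∀ {n} (x : Subset n) (A : List (Subset n)) → Dec (x ∈ A)
x ∈? A = ∈?-gen _≟ₛ_ x A

record SimplicialComplex (n : ℕ) : Set where
  field
    faces    : List (Subset n)
    unique   : Unique faces
    nonempty : All Nonempty faces
    closed   : ∀ {x y : Subset n} → x ∈ faces → Nonempty y → y ⊆ x → y ∈ faces
open SimplicialComplex public

module Energy {c ℓ : Level} (R : CommutativeRing c ℓ) where
  open CommutativeRing R

  Σ[_]_ : ∀ {a} {A : Set a} → List A → (A → Carrier) → Carrier
  Σ[ xs ] f = foldr (λ x acc → f x + acc) 0# xs

  -- ω(x) = (-1)^{dim x} with dim x = |x| - 1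
  ω : ∀ {n} → Subset n → Carrier
  ω x = sgn ∣ x ∣
    where
    sgn : ℕ → Carrier
    sgn zero = - 1#
    sgn (suc zero) = 1#
    sgn (suc (suc k)) = sgn k

  ωₕ : ∀ {n} → SimplicialComplex n → (Subset n → Subset n → Carrier)
     → List (Subset n) → Carrier
  ωₕ G h A = Σ[ faces G ] λ x → Σ[ faces G ] λ y →
               if does ((x ∩ y) ∈? A) then h x y else 0#

  U∩U : ∀ {n} → SimplicialComplex n → Subset n → Subset n → List (Subset n)
  U∩U G x y = filter (λ z → (x ⊆? z) ×-dec (y ⊆? z)) (faces G)

  g : ∀ {n} → SimplicialComplex n → (Subset n → Subset n → Carrier)
    → Subset n → Subset n → Carrier
  g G h x y = ω x * ω y * ωₕ G h (U∩U G x y)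

-- Expanding ω_h(U(x) ∩ U(y)) and exchanging sums, the coefficient of h(a,b) on the left is
-- [a ∩ b ∈ G] · e(a ∩ b)², where e(z) = Σ_{x ∈ G, x ⊆ z} ω(x).  For a face z the faces below z
-- are exactly the non-empty subsets of z, and Σ_{x ⊆ z} (-1)^{|x|-1} vanishes over all subsets
-- of a non-empty z; the empty set contributes -1, so e(z) = 1 and the coefficient is [a ∩ b ∈ G].
module Submission where

open import Defs
open import Level using (Level)
open import Data.Nat using (ℕ; zero; suc)
open import Data.Bool using (Bool; true; false; if_then_else_; not; _∧_)
open import Data.Vec using ([]; _∷_; replicate) renaming (there to vthere)
open import Data.Fin using () renaming (suc to fsuc)
open import Data.Fin.Subset using (Subset; _∩_; _⊆_; ∣_∣; Nonempty; ⊥)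
open import Data.Fin.Subset.Properties using (_⊆?_; nonempty?; Empty-unique; ∉⊥; ∣⊥∣≡0; ⊆-min)
open import Data.List using (List; []; _∷_; map; _++_)
open import Data.List.Membership.Propositional using () renaming (_∈_ to _∈ₗ_; _∉_ to _∉ₗ_)
open import Data.List.Membership.Propositional.Properties
  using (∈-filter⁺; ∈-filter⁻; ∈-map⁺; ∈-map⁻; ∈-++⁺ˡ; ∈-++⁺ʳ)
open import Data.List.Relation.Unary.All using (lookup; [])
open import Data.List.Relation.Unary.All.Properties using (All¬⇒¬Any)
open import Data.List.Relation.Unary.Any using (here; there)
open import Data.List.Relation.Unary.AllPairs using ([]; _∷_)
open import Data.List.Relation.Unary.Unique.Propositional using (Unique)
import Data.List.Relation.Unary.Unique.Propositional.Properties as Unique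
open import Data.Product using (_×_; _,_; proj₂)
open import Function.Bundles using (mk⇔)
open import Relation.Nullary using (yes; no; ¬_; contradiction)
open import Relation.Nullary.Decidable using (_×-dec_; does; does-⇔; dec-true; dec-false)
open import Relation.Binary.PropositionalEquality as ≡ using (_≡_)
open import Algebra.Bundles using (CommutativeRing)

module Properties {c ℓ : Level} (R : CommutativeRing c ℓ) where
  open CommutativeRing R
  open Energy R
  open import Relation.Binary.Reasoning.Setoid setoid
  open import Algebra.Properties.Ring ring using (-‿involutive; -‿distribʳ-*; -0#≈0#; -‿+-comm)
  import Algebra.Properties.CommutativeSemigroup as CommSemigroup
  open CommSemigroup +-commutativeSemigroup using () renaming (interchange to +-interchange)

  𝟙 : Bool → Carrier
  𝟙 true = 1#
  𝟙 false = 0#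

  𝟙-not : ∀ b t → 𝟙 (not b) * t ≈ t + - (𝟙 b * t)
  𝟙-not true t = begin
    0# * t           ≈⟨ zeroˡ t ⟩
    0#               ≈⟨ sym (-‿inverseʳ t) ⟩
    t + - t          ≈⟨ +-congˡ (-‿cong (sym (*-identityˡ t))) ⟩
    t + - (1# * t)   ∎
  𝟙-not false t = begin
    1# * t           ≈⟨ *-identityˡ t ⟩
    t                ≈⟨ sym (+-identityʳ t) ⟩
    t + 0#           ≈⟨ +-congˡ (sym (trans (-‿cong (zeroˡ t)) -0#≈0#)) ⟩
    t + - (0# * t)   ∎

  *-if-∧ : ∀ a b c u v t → u * v * (if (a ∧ b) ∧ c then t else 0#)
                          ≈ (𝟙 a * u) * ((𝟙 b * v) * (if c then t else 0#))
  *-if-∧ true  true  c u v t = begin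
    u * v * _                ≈⟨ *-assoc u v _ ⟩
    u * (v * _)              ≈⟨ *-cong (sym (*-identityˡ u)) (*-congʳ (sym (*-identityˡ v))) ⟩
    1# * u * (1# * v * _)    ∎
  *-if-∧ true  false c u v t = trans (zeroʳ _) (sym (trans (*-congˡ (trans (*-congʳ (zeroˡ v)) (zeroˡ _))) (zeroʳ _)))
  *-if-∧ false b     c u v t = trans (zeroʳ _) (sym (trans (*-congʳ (zeroˡ u)) (zeroˡ _)))

  Σ-cong : ∀ {a} {A : Set a} (xs : List A) {f g : A → Carrier} → (∀ x → f x ≈ g x) → Σ[ xs ] f ≈ Σ[ xs ] g
  Σ-cong []       f≈g = refl
  Σ-cong (x ∷ xs) f≈g = +-cong (f≈g x) (Σ-cong xs f≈g)

  Σ-zero : ∀ {a} {A : Set a} (xs : List A) {f : A → Carrier} → (∀ x → f x ≈ 0#) → Σ[ xs ] f ≈ 0#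
  Σ-zero []       f≈0 = refl
  Σ-zero (x ∷ xs) f≈0 = trans (+-cong (f≈0 x) (Σ-zero xs f≈0)) (+-identityˡ 0#)

  Σ-+ : ∀ {a} {A : Set a} (xs : List A) (f g : A → Carrier) → Σ[ xs ] (λ x → f x + g x) ≈ Σ[ xs ] f + Σ[ xs ] g
  Σ-+ []       f g = sym (+-identityˡ 0#)
  Σ-+ (x ∷ xs) f g = trans (+-congˡ (Σ-+ xs f g)) (+-interchange (f x) (g x) (Σ[ xs ] f) (Σ[ xs ] g))

  Σ-neg : ∀ {a} {A : Set a} (xs : List A) (f : A → Carrier) → Σ[ xs ] (λ x → - f x) ≈ - Σ[ xs ] f
  Σ-neg []       f = sym -0#≈0#
  Σ-neg (x ∷ xs) f = trans (+-congˡ (Σ-neg xs f)) (-‿+-comm (f x) _)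

  Σ-*ˡ : ∀ {a} {A : Set a} (xs : List A) (k : Carrier) (f : A → Carrier) → k * Σ[ xs ] f ≈ Σ[ xs ] (λ x → k * f x)
  Σ-*ˡ []       k f = zeroʳ k
  Σ-*ˡ (x ∷ xs) k f = trans (distribˡ k (f x) _) (+-congˡ (Σ-*ˡ xs k f))

  Σ-*ʳ : ∀ {a} {A : Set a} (xs : List A) (k : Carrier) (f : A → Carrier) → Σ[ xs ] f * k ≈ Σ[ xs ] (λ x → f x * k)
  Σ-*ʳ []       k f = zeroˡ k
  Σ-*ʳ (x ∷ xs) k f = trans (distribʳ k (f x) _) (+-congˡ (Σ-*ʳ xs k f))

  Σ-++ : ∀ {a} {A : Set a} (xs ys : List A) (f : A → Carrier) → Σ[ xs ++ ys ] f ≈ Σ[ xs ] f + Σ[ ys ] f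
  Σ-++ []       ys f = sym (+-identityˡ _)
  Σ-++ (x ∷ xs) ys f = trans (+-congˡ (Σ-++ xs ys f)) (sym (+-assoc _ _ _))

  Σ-map : ∀ {a b} {A : Set a} {B : Set b} (xs : List A) (g : A → B) (f : B → Carrier) →
          Σ[ map g xs ] f ≈ Σ[ xs ] (λ x → f (g x))
  Σ-map []       g f = refl
  Σ-map (x ∷ xs) g f = +-congˡ (Σ-map xs g f)

  Σ-swap : ∀ {a b} {A : Set a} {B : Set b} (xs : List A) (ys : List B) (f : A → B → Carrier) →
           Σ[ xs ] (λ x → Σ[ ys ] (f x)) ≈ Σ[ ys ] (λ y → Σ[ xs ] (λ x → f x y))
  Σ-swap []       ys f = sym (Σ-zero ys (λ _ → refl))
  Σ-swap (x ∷ xs) ys f = trans (+-congˡ (Σ-swap xs ys f)) (sym (Σ-+ ys (f x) _))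

  Σ²-swap : ∀ {a} {A : Set a} (xs : List A) (f : A → A → A → A → Carrier) →
            Σ[ xs ] (λ x → Σ[ xs ] λ y → Σ[ xs ] λ z → Σ[ xs ] λ w → f x y z w)
            ≈ Σ[ xs ] (λ z → Σ[ xs ] λ w → Σ[ xs ] λ x → Σ[ xs ] λ y → f x y z w)
  Σ²-swap xs f = begin
    Σ[ xs ] (λ x → Σ[ xs ] λ y → Σ[ xs ] λ z → Σ[ xs ] λ w → f x y z w)
      ≈⟨ Σ-cong xs (λ x → Σ-swap xs xs _) ⟩
    Σ[ xs ] (λ x → Σ[ xs ] λ z → Σ[ xs ] λ y → Σ[ xs ] λ w → f x y z w)
      ≈⟨ Σ-cong xs (λ x → Σ-cong xs (λ z → Σ-swap xs xs _)) ⟩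
    Σ[ xs ] (λ x → Σ[ xs ] λ z → Σ[ xs ] λ w → Σ[ xs ] λ y → f x y z w)
      ≈⟨ Σ-swap xs xs _ ⟩
    Σ[ xs ] (λ z → Σ[ xs ] λ x → Σ[ xs ] λ w → Σ[ xs ] λ y → f x y z w)
      ≈⟨ Σ-cong xs (λ z → Σ-swap xs xs _) ⟩
    Σ[ xs ] (λ z → Σ[ xs ] λ w → Σ[ xs ] λ x → Σ[ xs ] λ y → f x y z w) ∎

  Σ-𝟙-≟-∉ : ∀ {n} (xs : List (Subset n)) (a : Subset n) (f : Subset n → Carrier) → a ∉ₗ xs →
            Σ[ xs ] (λ x → 𝟙 (does (x ≟ₛ a)) * f x) ≈ 0#
  Σ-𝟙-≟-∉ []       a f _ = refl
  Σ-𝟙-≟-∉ (x ∷ xs) a f a∉ with x ≟ₛ a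
  ... | yes ≡.refl = contradiction (here ≡.refl) a∉
  ... | no _       = trans (+-cong (zeroˡ (f x)) (Σ-𝟙-≟-∉ xs a f (λ a∈ → a∉ (there a∈)))) (+-identityˡ 0#)

  Σ-𝟙-≟ : ∀ {n} (xs : List (Subset n)) (a : Subset n) (f : Subset n → Carrier) → Unique xs → a ∈ₗ xs →
          Σ[ xs ] (λ x → 𝟙 (does (x ≟ₛ a)) * f x) ≈ f a
  Σ-𝟙-≟ (x ∷ xs) a f (x∉xs ∷ _) (here ≡.refl) with x ≟ₛ x
  ... | no x≢x = contradiction ≡.refl x≢x
  ... | yes _  = trans (+-cong (*-identityˡ (f x)) (Σ-𝟙-≟-∉ xs x f (All¬⇒¬Any x∉xs))) (+-identityʳ (f x))
  Σ-𝟙-≟ (x ∷ xs) a f (x∉xs ∷ uxs) (there a∈xs) with x ≟ₛ a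
  ... | yes ≡.refl = contradiction a∈xs (All¬⇒¬Any x∉xs)
  ... | no _       = trans (+-cong (zeroˡ (f x)) (Σ-𝟙-≟ xs a f uxs a∈xs)) (+-identityˡ _)

  Σ-𝟙-∈ : ∀ {n} (L A : List (Subset n)) (f : Subset n → Carrier) → Unique L → Unique A →
          (∀ {x} → x ∈ₗ L → x ∈ₗ A) → Σ[ A ] (λ x → 𝟙 (does (x ∈? L)) * f x) ≈ Σ[ L ] f
  Σ-𝟙-∈ []      A f _          _  _   = Σ-zero A (λ x → zeroˡ (f x))
  Σ-𝟙-∈ (a ∷ L) A f (a∉L ∷ uL) uA L⊆A = begin
    Σ[ A ] (λ x → 𝟙 (does (x ∈? (a ∷ L))) * f x)
      ≈⟨ Σ-cong A split ⟩
    Σ[ A ] (λ x → 𝟙 (does (x ≟ₛ a)) * f x + 𝟙 (does (x ∈? L)) * f x)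
      ≈⟨ Σ-+ A _ _ ⟩
    Σ[ A ] (λ x → 𝟙 (does (x ≟ₛ a)) * f x) + Σ[ A ] (λ x → 𝟙 (does (x ∈? L)) * f x)
      ≈⟨ +-cong (Σ-𝟙-≟ A a f uA (L⊆A (here ≡.refl))) (Σ-𝟙-∈ L A f uL uA (λ x∈L → L⊆A (there x∈L))) ⟩
    f a + Σ[ L ] f ∎
    where
    split : ∀ x → 𝟙 (does (x ∈? (a ∷ L))) * f x ≈ 𝟙 (does (x ≟ₛ a)) * f x + 𝟙 (does (x ∈? L)) * f x
    split x with x ≟ₛ a | x ∈? L
    ... | yes ≡.refl | yes a∈L = contradiction a∈L (All¬⇒¬Any a∉L)
    ... | yes _      | no _    = sym (trans (+-congˡ (zeroˡ (f x))) (+-identityʳ _))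
    ... | no _       | _       = sym (trans (+-congʳ (zeroˡ (f x))) (+-identityˡ _))

  allSubsets : ∀ n → List (Subset n)
  allSubsets zero    = [] ∷ []
  allSubsets (suc n) = map (false ∷_) (allSubsets n) ++ map (true ∷_) (allSubsets n)

  ∈-allSubsets : ∀ {n} (x : Subset n) → x ∈ₗ allSubsets n
  ∈-allSubsets []                = here ≡.refl
  ∈-allSubsets {suc n} (false ∷ x) = ∈-++⁺ˡ (∈-map⁺ (false ∷_) (∈-allSubsets x))
  ∈-allSubsets {suc n} (true ∷ x)  = ∈-++⁺ʳ (map (false ∷_) (allSubsets n)) (∈-map⁺ (true ∷_) (∈-allSubsets x))

  allSubsets-unique : ∀ n → Unique (allSubsets n)
  allSubsets-unique zero    = [] ∷ []
  allSubsets-unique (suc n) =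
    Unique.++⁺ (Unique.map⁺ ∷-injectiveʳ (allSubsets-unique n)) (Unique.map⁺ ∷-injectiveʳ (allSubsets-unique n)) disjoint
    where
    ∷-injectiveʳ : ∀ {b} {x y : Subset n} → _≡_ {A = Subset (suc n)} (b ∷ x) (b ∷ y) → x ≡ y
    ∷-injectiveʳ ≡.refl = ≡.refl
    disjoint : ∀ {v} → ¬ (v ∈ₗ map (false ∷_) (allSubsets n) × v ∈ₗ map (true ∷_) (allSubsets n))
    disjoint (v∈₀ , v∈₁) with ∈-map⁻ (false ∷_) v∈₀ | ∈-map⁻ (true ∷_) v∈₁
    ... | _ , _ , ≡.refl | _ , _ , ()

  Σ-allSubsets-suc : ∀ n (f : Subset (suc n) → Carrier) →
                     Σ[ allSubsets (suc n) ] f ≈ Σ[ allSubsets n ] (λ x → f (false ∷ x)) + Σ[ allSubsets n ] (λ x → f (true ∷ x))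
  Σ-allSubsets-suc n f = trans (Σ-++ (map (false ∷_) (allSubsets n)) _ f)
                               (+-cong (Σ-map (allSubsets n) _ f) (Σ-map (allSubsets n) _ f))

  ω-cong-size : ∀ {m n} (x : Subset m) (y : Subset n) → ∣ x ∣ ≡ ∣ y ∣ → ω x ≡ ω y
  ω-cong-size x y eq rewrite eq = ≡.refl

  ∣replicate-true∣ : ∀ k → ∣ replicate k true ∣ ≡ k
  ∣replicate-true∣ zero    = ≡.refl
  ∣replicate-true∣ (suc k) = ≡.cong suc (∣replicate-true∣ k)

  -- ω depends only on ∣ x ∣ through a sign function local to Defs, so a size k is represented
  -- by the subset replicate k true.
  ω-replicate-suc : ∀ k → ω (replicate (suc k) true) ≈ - ω (replicate k true)
  ω-replicate-suc zero          = sym (-‿involutive 1#)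
  ω-replicate-suc (suc zero)    = refl
  ω-replicate-suc (suc (suc k)) = ω-replicate-suc k

  ω-true∷ : ∀ {n} (x : Subset n) → ω (true ∷ x) ≈ - ω x
  ω-true∷ x = begin
    ω (true ∷ x)                       ≡⟨ ω-cong-size (true ∷ x) (replicate (suc ∣ x ∣) true) (≡.sym (∣replicate-true∣ (suc ∣ x ∣))) ⟩
    ω (replicate (suc ∣ x ∣) true)     ≈⟨ ω-replicate-suc ∣ x ∣ ⟩
    - ω (replicate ∣ x ∣ true)         ≡⟨ ≡.cong -_ (ω-cong-size (replicate ∣ x ∣ true) x (∣replicate-true∣ ∣ x ∣)) ⟩
    - ω x                              ∎

  ω-⊥ : ∀ n → ω (⊥ {n}) ≈ - 1#
  ω-⊥ n = reflexive (ω-cong-size (⊥ {n}) [] (∣⊥∣≡0 n))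

  ω-below : ∀ {n} → Subset n → Subset n → Carrier
  ω-below z x = 𝟙 (does (x ⊆? z)) * ω x

  Σ-ω-below≈0 : ∀ {n} (z : Subset n) → Nonempty z → Σ[ allSubsets n ] (ω-below z) ≈ 0#
  Σ-ω-below≈0 {suc n} (false ∷ z) (fsuc i , vthere i∈z) = begin
    _ ≈⟨ Σ-allSubsets-suc n _ ⟩
    Σ[ allSubsets n ] (ω-below z) + Σ[ allSubsets n ] (λ x → 0# * ω (true ∷ x))
      ≈⟨ +-cong (Σ-ω-below≈0 z (i , i∈z)) (Σ-zero (allSubsets n) (λ x → zeroˡ _)) ⟩
    0# + 0# ≈⟨ +-identityˡ 0# ⟩
    0# ∎
  Σ-ω-below≈0 {suc n} (true ∷ z) _ = begin
    _ ≈⟨ Σ-allSubsets-suc n _ ⟩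
    Σ[ allSubsets n ] (ω-below z) + Σ[ allSubsets n ] (λ x → 𝟙 (does (x ⊆? z)) * ω (true ∷ x))
      ≈⟨ +-congˡ (Σ-cong (allSubsets n) (λ x → trans (*-congˡ (ω-true∷ x)) (sym (-‿distribʳ-* _ _)))) ⟩
    Σ[ allSubsets n ] (ω-below z) + Σ[ allSubsets n ] (λ x → - ω-below z x)
      ≈⟨ +-congˡ (Σ-neg (allSubsets n) (ω-below z)) ⟩
    Σ[ allSubsets n ] (ω-below z) + - Σ[ allSubsets n ] (ω-below z)
      ≈⟨ -‿inverseʳ _ ⟩
    0# ∎

  module _ {n} (G : SimplicialComplex n) where

    ∈-faces-below-face : ∀ {x z} → z ∈ₗ faces G → x ⊆ z → does (x ∈? faces G) ≡ not (does (x ≟ₛ ⊥))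
    ∈-faces-below-face {x} z∈G x⊆z with x ≟ₛ ⊥
    ... | yes ≡.refl = dec-false (⊥ ∈? faces G) (λ ⊥∈G → ∉⊥ (proj₂ (lookup (nonempty G) ⊥∈G)))
    ... | no x≢⊥ with nonempty? x
    ...   | yes x≠∅ = dec-true (x ∈? faces G) (closed G z∈G x≠∅ x⊆z)
    ...   | no x=∅  = contradiction (Empty-unique x=∅) x≢⊥

    eulerBelow : Subset n → Carrier
    eulerBelow z = Σ[ faces G ] (ω-below z)

    eulerBelow-face≈1 : ∀ {z} → z ∈ₗ faces G → eulerBelow z ≈ 1#
    eulerBelow-face≈1 {z} z∈G = begin
      eulerBelow z
        ≈⟨ sym (Σ-𝟙-∈ (faces G) S e (unique G) (allSubsets-unique n) (λ {x} _ → ∈-allSubsets x)) ⟩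
      Σ[ S ] (λ x → 𝟙 (does (x ∈? faces G)) * e x)      ≈⟨ Σ-cong S ∅-only-nonface ⟩
      Σ[ S ] (λ x → 𝟙 (not (does (x ≟ₛ ⊥))) * e x)     ≈⟨ Σ-cong S (λ x → 𝟙-not (does (x ≟ₛ ⊥)) (e x)) ⟩
      Σ[ S ] (λ x → e x + - (𝟙 (does (x ≟ₛ ⊥)) * e x))  ≈⟨ Σ-+ S e _ ⟩
      Σ[ S ] e + Σ[ S ] (λ x → - (𝟙 (does (x ≟ₛ ⊥)) * e x))
        ≈⟨ +-cong (Σ-ω-below≈0 z (lookup (nonempty G) z∈G)) (Σ-neg S _) ⟩
      0# + - Σ[ S ] (λ x → 𝟙 (does (x ≟ₛ ⊥)) * e x)
        ≈⟨ +-identityˡ _ ⟩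
      - Σ[ S ] (λ x → 𝟙 (does (x ≟ₛ ⊥)) * e x)       ≈⟨ -‿cong (Σ-𝟙-≟ S ⊥ e (allSubsets-unique n) (∈-allSubsets ⊥)) ⟩
      - e ⊥                                           ≡⟨ ≡.cong (λ b → - (𝟙 b * ω (⊥ {n}))) (dec-true (⊥ {n} ⊆? z) (⊆-min z)) ⟩
      - (1# * ω (⊥ {n}))                              ≈⟨ -‿cong (trans (*-identityˡ _) (ω-⊥ n)) ⟩
      - - 1#                                          ≈⟨ -‿involutive 1# ⟩
      1# ∎
      where
      S = allSubsets n
      e = ω-below z
      ∅-only-nonface : ∀ x → 𝟙 (does (x ∈? faces G)) * e x ≈ 𝟙 (not (does (x ≟ₛ ⊥))) * e x
      ∅-only-nonface x with x ⊆? z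
      ... | yes x⊆z = reflexive (≡.cong (λ b → 𝟙 b * (1# * ω x)) (∈-faces-below-face z∈G x⊆z))
      ... | no _    = trans (*-congˡ (zeroˡ (ω x))) (trans (zeroʳ _) (sym (trans (*-congˡ (zeroˡ (ω x))) (zeroʳ _))))

    does-∈-U∩U : ∀ x y z → does (z ∈? U∩U G x y) ≡ (does (x ⊆? z) ∧ does (y ⊆? z)) ∧ does (z ∈? faces G)
    does-∈-U∩U x y z = does-⇔ (mk⇔ to from) (z ∈? U∩U G x y) (((x ⊆? z) ×-dec (y ⊆? z)) ×-dec (z ∈? faces G))
      where
      to : z ∈ₗ U∩U G x y → (x ⊆ z × y ⊆ z) × z ∈ₗ faces G
      to z∈U with ∈-filter⁻ (λ w → (x ⊆? w) ×-dec (y ⊆? w)) {xs = faces G} z∈U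
      ... | z∈G , x,y⊆z = x,y⊆z , z∈G
      from : (x ⊆ z × y ⊆ z) × z ∈ₗ faces G → z ∈ₗ U∩U G x y
      from (x,y⊆z , z∈G) = ∈-filter⁺ (λ w → (x ⊆? w) ×-dec (y ⊆? w)) z∈G x,y⊆z

    eulerBelow²-absorbs : ∀ z t → eulerBelow z * (eulerBelow z * (if does (z ∈? faces G) then t else 0#))
                                 ≈ (if does (z ∈? faces G) then t else 0#)
    eulerBelow²-absorbs z t with z ∈? faces G
    ... | yes z∈G = trans (*-cong (eulerBelow-face≈1 z∈G) (*-congʳ (eulerBelow-face≈1 z∈G)))
                          (trans (*-identityˡ _) (*-identityˡ t))
    ... | no _    = trans (*-congˡ (zeroʳ _)) (zeroʳ _)

    Σ²-ω-U∩U : ∀ z t → Σ[ faces G ] (λ x → Σ[ faces G ] λ y → ω x * ω y * (if does (z ∈? U∩U G x y) then t else 0#))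
                        ≈ (if does (z ∈? faces G) then t else 0#)
    Σ²-ω-U∩U z t = begin
      Σ[ F ] (λ x → Σ[ F ] λ y → ω x * ω y * (if does (z ∈? U∩U G x y) then t else 0#))
        ≈⟨ Σ-cong F (λ x → Σ-cong F (λ y → factor x y)) ⟩
      Σ[ F ] (λ x → Σ[ F ] λ y → e x * (e y * T))  ≈⟨ Σ-cong F (λ x → sym (Σ-*ˡ F (e x) _)) ⟩
      Σ[ F ] (λ x → e x * Σ[ F ] λ y → e y * T)    ≈⟨ sym (Σ-*ʳ F _ e) ⟩
      eulerBelow z * Σ[ F ] (λ y → e y * T)        ≈⟨ *-congˡ (sym (Σ-*ʳ F T e)) ⟩
      eulerBelow z * (eulerBelow z * T)            ≈⟨ eulerBelow²-absorbs z t ⟩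
      T ∎
      where
      F = faces G
      T = if does (z ∈? F) then t else 0#
      e = ω-below z
      factor : ∀ x y → ω x * ω y * (if does (z ∈? U∩U G x y) then t else 0#) ≈ e x * (e y * T)
      factor x y = begin
        ω x * ω y * (if does (z ∈? U∩U G x y) then t else 0#)
          ≡⟨ ≡.cong (λ b → ω x * ω y * (if b then t else 0#)) (does-∈-U∩U x y z) ⟩
        ω x * ω y * (if (does (x ⊆? z) ∧ does (y ⊆? z)) ∧ does (z ∈? F) then t else 0#)
          ≈⟨ *-if-∧ (does (x ⊆? z)) (does (y ⊆? z)) (does (z ∈? F)) (ω x) (ω y) t ⟩
        e x * (e y * T) ∎

mainTheorem11 : ∀ {c ℓ : Level} (R : CommutativeRing c ℓ) (n : ℕ)
    (G : SimplicialComplex n)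
    (h : Subset n → Subset n → CommutativeRing.Carrier R) →
    let open CommutativeRing R using (_≈_)
        open Energy R
    in (Σ[ faces G ] λ x → Σ[ faces G ] λ y → g G h x y) ≈ ωₕ G h (faces G)
mainTheorem11 R n G h = begin
  Σ[ F ] (λ x → Σ[ F ] λ y → ω x * ω y * Σ[ F ] λ a → Σ[ F ] λ b → I x y a b)
    ≈⟨ Σ-cong F (λ x → Σ-cong F (λ y → trans (Σ-*ˡ F _ _) (Σ-cong F (λ a → Σ-*ˡ F _ _)))) ⟩
  Σ[ F ] (λ x → Σ[ F ] λ y → Σ[ F ] λ a → Σ[ F ] λ b → ω x * ω y * I x y a b)
    ≈⟨ Σ²-swap F _ ⟩
  Σ[ F ] (λ a → Σ[ F ] λ b → Σ[ F ] λ x → Σ[ F ] λ y → ω x * ω y * I x y a b)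
    ≈⟨ Σ-cong F (λ a → Σ-cong F (λ b → Σ²-ω-U∩U G (a ∩ b) (h a b))) ⟩
  ωₕ G h F ∎
  where
  open CommutativeRing R
  open Energy R
  open Properties R
  open import Relation.Binary.Reasoning.Setoid setoid
  F = faces G
  I : Subset n → Subset n → Subset n → Subset n → Carrier
  I x y a b = if does ((a ∩ b) ∈? U∩U G x y) then h a b else 0#
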